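{- For $n>1$, the number of DFS trees on $n$ vertices of height at most $2$ is $2^{n-2}$.
   Context: $B_n$ is the set of bracketings of $x_1x_2\cdots x_n$ (binary terms with $x_1,\dots,x_n$ each occurring once, in this order). For $t\in B_n$, $G(t)$ is the rooted tree on $\{x_1,\dots,x_n\}$ defined recursively: $G(x_i)$ is the single vertex $x_i$; for $t=t_1t_2$, $G(t)$ is $G(t_1)\cup G(t_2)$ plus an edge from the root of $G(t_1)$ to the root of $G(t_2)$, rooted at the root of $G(t_1)$. A DFS tree on $n$ vertices is a tree of the form $G(t)$ with $t\in B_n$. The height is the maximum depth (distance from the root) of a vertex. -}

module Defs where

open import Data.Nat using (ℕ; zero; suc; _+_; _≤_; _<_)
open import Data.Maybe using (Maybe; just; nothing)
open import Data.Vec using (Vec; []; _∷_; _++_)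
open import Data.Product using (_×_; _,_; ∃; proj₁; proj₂)
open import Relation.Nullary using (yes; no)
open import Relation.Binary.PropositionalEquality using (_≡_)
import Data.Nat as ℕ

-- Bracketings of x_1 ... x_n (B_n): binary terms whose leaves are
-- x_1,...,x_n in order.  A term of size n is determined by its shape.
data Br : ℕ → Set where
  leaf : Br 1
  node : ∀ {a b} → Br a → Br b → Br (a + b)

-- A rooted tree on the vertices x_1..x_n, encoded with 0-based indices
-- (vertex x_(i+1) is index i): the root index together with the parent
-- vector (entry i is the parent of vertex i, or nothing).  A rooted tree
-- is uniquely determined by this data, so equality of trees is ≡.
Tree : ℕ → Set
Tree n = ℕ × Vec (Maybe ℕ) n

setParent : ∀ {m} → ℕ → ℕ → ℕ → Vec (Maybe ℕ) m → Vec (Maybe ℕ) m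
setParent pos c r [] = []
setParent pos c r (x ∷ v) with pos ℕ.≟ c
... | yes _ = just r ∷ setParent (suc pos) c r v
... | no  _ = x ∷ setParent (suc pos) c r v

-- G with an offset k: the leaves of the term are vertices k, k+1, ...
Gₖ : ∀ {n} → ℕ → Br n → Tree n
Gₖ k leaf = k , (nothing ∷ [])
Gₖ k (node {a} t₁ t₂) with Gₖ k t₁ | Gₖ (k + a) t₂
... | (r₁ , p₁) | (r₂ , p₂) = r₁ , (p₁ ++ setParent (k + a) r₂ r₁ p₂)

G : ∀ {n} → Br n → Tree n
G = Gₖ 0

IsDFSTree : ∀ {n} → Tree n → Set
IsDFSTree {n} T = ∃ λ (t : Br n) → G t ≡ T

_!_ : ∀ {A : Set} {n} → Vec A n → ℕ → Maybe A
[] ! i = nothing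
(x ∷ v) ! zero = just x
(x ∷ v) ! suc i = v ! i

data Depth {n} (T : Tree n) : ℕ → ℕ → Set where
  root : Depth T (proj₁ T) 0
  step : ∀ {i j d} → proj₂ T ! i ≡ just (just j) → Depth T j d → Depth T i (suc d)

HeightAtMost : ∀ {n} → Tree n → ℕ → Set
HeightAtMost {n} T h = ∀ i → i < n → ∃ λ d → d ≤ h × Depth T i d

{-# OPTIONS --safe #-}
-- For t = t₁t₂ the tree G(t) is G(t₁) with G(t₂) hung below its root, so G(t) has height
-- at most 2 exactly when G(t₁) has and G(t₂) is a star. Unfolding this, a DFS tree of height
-- at most 2 is determined by saying, for each of x₃, …, xₙ, whether it is a child of the root
-- x₁ or of the latest child of the root; conversely every such choice is realised by a
-- bracketing (…((x₁ s₁) s₂) …) s_r whose subterms s_i are left combs.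
module Submission where

open import Defs
open import Data.Nat using (ℕ; zero; suc; _+_; _<_; _≤_; _∸_; _^_; z≤n; s≤s)
import Data.Nat as ℕ
open import Data.Nat.Properties
open import Data.Bool using (Bool; true; false)
open import Data.Maybe using (Maybe; just; nothing)
open import Data.Vec using (Vec; []; _∷_; toList; fromList; cast)
import Data.Vec as Vec
open import Data.Vec.Properties
  using (toList-++; toList-injective; cast-is-id; length-toList; toList-cast; toList∘fromList)
  renaming (∷-injectiveʳ to ∷-injectiveʳᵛ)
open import Data.List using (List; []; _∷_; _++_; length; replicate; map)
open import Data.List.Properties
  using (length-++; length-++-≤ˡ; ++-assoc; ++-identityʳ; ∷-injective; ∷-injectiveʳ; length-map)
open import Data.List.Relation.Unary.Unique.Propositional using (Unique)
import Data.List.Relation.Unary.Unique.Propositional.Properties as Unique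
open import Data.List.Membership.Propositional using (_∈_)
open import Data.List.Membership.Propositional.Properties using (∈-map⁺; ∈-map⁻; ∈-++⁺ˡ; ∈-++⁺ʳ)
open import Data.List.Relation.Unary.Any using (here)
open import Data.List.Relation.Unary.All using ([])
open import Data.List.Relation.Unary.AllPairs using ([]; _∷_)
open import Data.Product using (_×_; _,_; ∃; Σ; proj₁; proj₂)
open import Data.Sum using (_⊎_; inj₁; inj₂)
open import Data.Empty using (⊥; ⊥-elim)
open import Function.Bundles using (_⇔_; mk⇔; module Equivalence)
open import Function using (_∘_)
open import Relation.Nullary using (yes; no)
open import Relation.Binary.PropositionalEquality

private variable
  A : Set
  n m : ℕ

_‼_ : List A → ℕ → Maybe A
[] ‼ i = nothing
(x ∷ xs) ‼ zero = just x
(x ∷ xs) ‼ suc i = xs ‼ i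

!-toList : (v : Vec A n) (i : ℕ) → v ! i ≡ toList v ‼ i
!-toList [] i = refl
!-toList (x ∷ v) zero = refl
!-toList (x ∷ v) (suc i) = !-toList v i

‼-++ˡ : (xs ys : List A) {i : ℕ} → i < length xs → (xs ++ ys) ‼ i ≡ xs ‼ i
‼-++ˡ (x ∷ xs) ys {zero} _ = refl
‼-++ˡ (x ∷ xs) ys {suc i} (s≤s i<) = ‼-++ˡ xs ys i<

‼-++ʳ : (xs ys : List A) (i : ℕ) → (xs ++ ys) ‼ (length xs + i) ≡ ys ‼ i
‼-++ʳ [] ys i = refl
‼-++ʳ (x ∷ xs) ys i = ‼-++ʳ xs ys i

‼-++⁻ : (xs ys : List A) {i : ℕ} {y : A} → (xs ++ ys) ‼ i ≡ just y →
        xs ‼ i ≡ just y ⊎ ∃ λ k → i ≡ length xs + k × ys ‼ k ≡ just y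
‼-++⁻ [] ys eq = inj₂ (_ , refl , eq)
‼-++⁻ (x ∷ xs) ys {zero} eq = inj₁ eq
‼-++⁻ (x ∷ xs) ys {suc i} eq with ‼-++⁻ xs ys eq
... | inj₁ eq′ = inj₁ eq′
... | inj₂ (k , refl , eq′) = inj₂ (k , refl , eq′)

‼-replicate : (xs : List A) {x : A} → (∀ {i} → i < length xs → xs ‼ i ≡ just x) →
              xs ≡ replicate (length xs) x
‼-replicate [] _ = refl
‼-replicate (y ∷ xs) all-x with all-x {0} (s≤s z≤n)
... | refl = cong (y ∷_) (‼-replicate xs (λ i< → all-x (s≤s i<)))

Parent : List (Maybe ℕ) → ℕ → ℕ → Set
Parent W i j = W ‼ i ≡ just (just j)

AtDepth≤2 : List (Maybe ℕ) → ℕ → Set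
AtDepth≤2 W i = i ≡ 0 ⊎ Parent W i 0 ⊎ ∃ λ j → Parent W i j × Parent W j 0

Height≤2 : List (Maybe ℕ) → Set
Height≤2 W = ∀ {i} → i < length W → AtDepth≤2 W i

heightAtMost2⇔Height≤2 : (v : Vec (Maybe ℕ) n) → HeightAtMost (0 , v) 2 ⇔ Height≤2 (toList v)
heightAtMost2⇔Height≤2 v = mk⇔ to from
  where
  to : HeightAtMost (0 , v) 2 → Height≤2 (toList v)
  to h {i} i< with h i (subst (i <_) (length-toList v) i<)
  ... | _ , _ , root = inj₁ refl
  ... | _ , _ , step p root = inj₂ (inj₁ (trans (sym (!-toList v i)) p))
  ... | _ , _ , step {j = j} p (step q root) =
    inj₂ (inj₂ (j , trans (sym (!-toList v i)) p , trans (sym (!-toList v j)) q))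
  ... | _ , s≤s (s≤s ()) , step _ (step _ (step _ _))
  from : Height≤2 (toList v) → HeightAtMost (0 , v) 2
  from h i i< with h (subst (i <_) (sym (length-toList v)) i<)
  ... | inj₁ refl = 0 , z≤n , root
  ... | inj₂ (inj₁ p) = 1 , s≤s z≤n , step (trans (!-toList v i) p) root
  ... | inj₂ (inj₂ (j , p , q)) =
    2 , ≤-refl , step (trans (!-toList v i) p) (step (trans (!-toList v j) q) root)

setParent-below : ∀ pos c r (v : Vec (Maybe ℕ) n) → c < pos → setParent pos c r v ≡ v
setParent-below pos c r [] _ = refl
setParent-below pos c r (x ∷ v) c< with pos ℕ.≟ c
... | yes refl = ⊥-elim (<-irrefl refl c<)
... | no _ = cong (x ∷_) (setParent-below (suc pos) c r v (m<n⇒m<1+n c<))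

setParent-head : ∀ pos r (v : Vec (Maybe ℕ) n) {x xs} → toList v ≡ x ∷ xs →
                 toList (setParent pos pos r v) ≡ just r ∷ xs
setParent-head pos r (y ∷ v) eq with pos ℕ.≟ pos
... | no pos≢pos = ⊥-elim (pos≢pos refl)
... | yes _ rewrite setParent-below (suc pos) pos r v (n<1+n pos) = cong (just r ∷_) (∷-injectiveʳ eq)

parents : ℕ → Br n → List (Maybe ℕ)
parents k leaf = []
parents k (node {a} t₁ t₂) = parents k t₁ ++ just k ∷ parents (k + a) t₂

root-Gₖ : ∀ k (t : Br n) → proj₁ (Gₖ k t) ≡ k
root-Gₖ k leaf = refl
root-Gₖ k (node t₁ t₂) = root-Gₖ k t₁

toList-Gₖ : ∀ k (t : Br n) → toList (proj₂ (Gₖ k t)) ≡ nothing ∷ parents k t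
toList-Gₖ k leaf = refl
toList-Gₖ k (node {a} t₁ t₂) rewrite root-Gₖ k t₁ | root-Gₖ (k + a) t₂ = begin
  toList (proj₂ (Gₖ k t₁) Vec.++ setParent (k + a) (k + a) k (proj₂ (Gₖ (k + a) t₂)))
    ≡⟨ toList-++ (proj₂ (Gₖ k t₁)) _ ⟩
  toList (proj₂ (Gₖ k t₁)) ++ toList (setParent (k + a) (k + a) k (proj₂ (Gₖ (k + a) t₂)))
    ≡⟨ cong₂ _++_ (toList-Gₖ k t₁) (setParent-head (k + a) k _ (toList-Gₖ (k + a) t₂)) ⟩
  nothing ∷ parents k t₁ ++ just k ∷ parents (k + a) t₂ ∎
  where open ≡-Reasoning

length-parents : ∀ k (t : Br n) → suc (length (parents k t)) ≡ n
length-parents k leaf = refl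
length-parents k (node {a} {b} t₁ t₂) = begin
  suc (length (parents k t₁ ++ just k ∷ parents (k + a) t₂))
    ≡⟨ cong suc (length-++ (parents k t₁)) ⟩
  suc (length (parents k t₁)) + suc (length (parents (k + a) t₂))
    ≡⟨ cong₂ _+_ (length-parents k t₁) (length-parents (k + a) t₂) ⟩
  a + b ∎
  where open ≡-Reasoning

parents-bounded : ∀ k (t : Br n) {i j} → Parent (parents k t) i j → k ≤ j × j ≤ k + i
parents-bounded k leaf ()
parents-bounded k (node {a} t₁ t₂) p with ‼-++⁻ (parents k t₁) _ p
... | inj₁ p₁ = parents-bounded k t₁ p₁
... | inj₂ (zero , refl , refl) = ≤-refl , m≤m+n k _
... | inj₂ (suc i , refl , p₂) with parents-bounded (k + a) t₂ p₂
...   | k+a≤j , j≤k+a+i = ≤-trans (m≤m+n k a) k+a≤j , ≤-trans j≤k+a+i (≤-reflexive index)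
  where
  open ≡-Reasoning
  index : k + a + i ≡ k + (length (parents k t₁) + suc i)
  index = begin
    k + a + i                                ≡⟨ +-assoc k a i ⟩
    k + (a + i)                              ≡⟨ cong (λ a → k + (a + i)) (sym (length-parents k t₁)) ⟩
    k + (suc (length (parents k t₁)) + i)    ≡⟨ cong (k +_) (sym (+-suc _ i)) ⟩
    k + (length (parents k t₁) + suc i)      ∎

toList-injective′ : {xs ys : Vec A n} → toList xs ≡ toList ys → xs ≡ ys
toList-injective′ {xs = xs} {ys} eq = trans (sym (cast-is-id refl xs)) (toList-injective refl xs ys eq)

toList-surjective : (xs : List A) → length xs ≡ n → ∃ λ (v : Vec A n) → toList v ≡ xs
toList-surjective xs eq = cast eq (fromList xs) , trans (toList-cast eq (fromList xs)) (toList∘fromList xs)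

G-rooted : (t : Br n) → G t ≡ (0 , proj₂ (G t))
G-rooted t = cong (_, proj₂ (G t)) (root-Gₖ 0 t)

G-cong : (t t′ : Br n) → parents 0 t ≡ parents 0 t′ → G t ≡ G t′
G-cong t t′ eq = begin
  G t                   ≡⟨ G-rooted t ⟩
  (0 , proj₂ (G t))     ≡⟨ cong (0 ,_) (toList-injective′ (begin
    toList (proj₂ (G t))   ≡⟨ toList-Gₖ 0 t ⟩
    nothing ∷ parents 0 t  ≡⟨ cong (nothing ∷_) eq ⟩
    nothing ∷ parents 0 t′ ≡⟨ toList-Gₖ 0 t′ ⟨
    toList (proj₂ (G t′))  ∎)) ⟩
  (0 , proj₂ (G t′))    ≡⟨ G-rooted t′ ⟨
  G t′                  ∎
  where open ≡-Reasoning

G-height≤2 : (t : Br n) → HeightAtMost (G t) 2 ⇔ Height≤2 (nothing ∷ parents 0 t)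
G-height≤2 t = subst (λ W → HeightAtMost (G t) 2 ⇔ Height≤2 W) (toList-Gₖ 0 t) atRoot
  where
  atRoot : HeightAtMost (G t) 2 ⇔ Height≤2 (toList (proj₂ (G t)))
  atRoot = subst (λ T → HeightAtMost T 2 ⇔ Height≤2 (toList (proj₂ T))) (sym (G-rooted t))
                 (heightAtMost2⇔Height≤2 (proj₂ (G t)))

-- The parents of the vertices pos, pos + 1, … of a tree in which c is the latest child of
-- the root: the bit true makes a vertex a new child of the root, false a child of c.
flatParents : ℕ → ℕ → List Bool → List (Maybe ℕ)
flatParents pos c [] = []
flatParents pos c (true ∷ bs) = just 0 ∷ flatParents (suc pos) pos bs
flatParents pos c (false ∷ bs) = just c ∷ flatParents (suc pos) c bs

length-flatParents : ∀ pos c bs → length (flatParents pos c bs) ≡ length bs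
length-flatParents pos c [] = refl
length-flatParents pos c (true ∷ bs) = cong suc (length-flatParents (suc pos) pos bs)
length-flatParents pos c (false ∷ bs) = cong suc (length-flatParents (suc pos) c bs)

flatParents-replicate : ∀ pos c r → flatParents pos c (replicate r false) ≡ replicate r (just c)
flatParents-replicate pos c zero = refl
flatParents-replicate pos c (suc r) = cong (just c ∷_) (flatParents-replicate (suc pos) c r)

flatParents-++ : ∀ pos c bs bs′ → flatParents pos c (bs ++ true ∷ bs′) ≡
                 flatParents pos c bs ++ just 0 ∷ flatParents (suc (pos + length bs)) (pos + length bs) bs′
flatParents-++ pos c [] bs′ rewrite +-identityʳ pos = refl
flatParents-++ pos c (true ∷ bs) bs′ rewrite +-suc pos (length bs) =
  cong (just 0 ∷_) (flatParents-++ (suc pos) pos bs bs′)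
flatParents-++ pos c (false ∷ bs) bs′ rewrite +-suc pos (length bs) =
  cong (just c ∷_) (flatParents-++ (suc pos) c bs bs′)

flatParents-injective : ∀ {pos c c′} bs bs′ →
  flatParents (suc pos) (suc c) bs ≡ flatParents (suc pos) (suc c′) bs′ → bs ≡ bs′
flatParents-injective [] [] _ = refl
flatParents-injective (true ∷ bs) (true ∷ bs′) eq =
  cong (true ∷_) (flatParents-injective bs bs′ (∷-injectiveʳ eq))
flatParents-injective (false ∷ bs) (false ∷ bs′) eq with ∷-injective eq
... | refl , eq′ = cong (false ∷_) (flatParents-injective bs bs′ eq′)
flatParents-injective [] (true ∷ _) ()
flatParents-injective [] (false ∷ _) ()
flatParents-injective (true ∷ _) [] ()
flatParents-injective (false ∷ _) [] ()
flatParents-injective (true ∷ _) (false ∷ _) ()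
flatParents-injective (false ∷ _) (true ∷ _) ()

Backward : List (Maybe ℕ) → Set
Backward W = ∀ {i j} → Parent W i j → j < i

backward-parents : (t : Br n) → Backward (nothing ∷ parents 0 t)
backward-parents t {suc i} p = s≤s (proj₂ (parents-bounded 0 t p))

height≤2-prefix : ∀ W Q → Backward W → Height≤2 (W ++ Q) → Height≤2 W
height≤2-prefix W Q backward h {i} i< = atDepth (h (<-≤-trans i< (length-++-≤ˡ W)))
  where
  inW : ∀ {k j} → k < length W → Parent (W ++ Q) k j → Parent W k j
  inW k< = trans (sym (‼-++ˡ W Q k<))
  atDepth : AtDepth≤2 (W ++ Q) i → AtDepth≤2 W i
  atDepth (inj₁ i≡0) = inj₁ i≡0
  atDepth (inj₂ (inj₁ p)) = inj₂ (inj₁ (inW i< p))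
  atDepth (inj₂ (inj₂ (j , p , q))) = inj₂ (inj₂ (j , pᵂ , inW (<-trans (backward pᵂ) i<) q))
    where pᵂ = inW i< p

height≤2-suffix : ∀ W Q → 0 < length W → (∀ {i j} → Parent Q i j → length W ≤ j) →
                  Height≤2 (W ++ just 0 ∷ Q) → ∀ {i} → i < length Q → Parent Q i (length W)
height≤2-suffix W Q 0<W above h {i} i< = atDepth (h index<)
  where
  index< : length W + suc i < length (W ++ just 0 ∷ Q)
  index< = subst (length W + suc i <_) (sym (length-++ W)) (+-monoʳ-< (length W) (s≤s i<))
  inQ : ∀ {k j} → Parent (W ++ just 0 ∷ Q) (length W + suc k) j → Parent Q k j
  inQ {k} = trans (sym (‼-++ʳ W _ (suc k)))
  notChildOfRoot : ∀ {k} → Parent Q k 0 → ⊥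
  notChildOfRoot p = n≮0 (<-≤-trans 0<W (above p))
  viaParent : ∀ d → Parent Q i (length W + d) → Parent (W ++ just 0 ∷ Q) (length W + d) 0 →
              Parent Q i (length W)
  viaParent zero p _ = subst (Parent Q i) (+-identityʳ (length W)) p
  viaParent (suc k) _ q = ⊥-elim (notChildOfRoot (inQ q))
  atDepth : AtDepth≤2 (W ++ just 0 ∷ Q) (length W + suc i) → Parent Q i (length W)
  atDepth (inj₁ index≡0) = ⊥-elim (1+n≢0 (trans (sym (+-suc (length W) i)) index≡0))
  atDepth (inj₂ (inj₁ p)) = ⊥-elim (notChildOfRoot (inQ p))
  atDepth (inj₂ (inj₂ (j , p , q))) with m≤n⇒∃[o]m+o≡n (above (inQ p))
  ... | d , refl = viaParent d (inQ p) q

height≤2-node : ∀ {a b} (t₁ : Br a) (t₂ : Br b) → Height≤2 (nothing ∷ parents 0 (node t₁ t₂)) →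
  Height≤2 (nothing ∷ parents 0 t₁) × parents a t₂ ≡ replicate (length (parents a t₂)) (just a)
height≤2-node {a} t₁ t₂ h =
  height≤2-prefix W₁ _ (backward-parents t₁) h ,
  ‼-replicate (parents a t₂) (λ i< → subst (Parent (parents a t₂) _) (length-parents 0 t₁)
                                           (height≤2-suffix W₁ _ (s≤s z≤n) above h i<))
  where
  W₁ = nothing ∷ parents 0 t₁
  above : ∀ {i j} → Parent (parents a t₂) i j → length W₁ ≤ j
  above p = subst (_≤ _) (sym (length-parents 0 t₁)) (proj₁ (parents-bounded a t₂ p))

-- Starting with 1 as the latest child of the root is harmless, since vertex 1 is always a
-- child of the root, and keeps the induction free of a case for the first subtree.
height≤2⇒parents-flat : (t : Br n) → Height≤2 (nothing ∷ parents 0 t) →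
                        ∃ λ bs → parents 0 t ≡ flatParents 1 1 bs
height≤2⇒parents-flat leaf _ = [] , refl
height≤2⇒parents-flat (node {a} t₁ t₂) h with height≤2-node t₁ t₂ h
... | h₁ , star with height≤2⇒parents-flat t₁ h₁
... | bs₁ , eq₁ = bs₁ ++ true ∷ replicate r false , (begin
  parents 0 t₁ ++ just 0 ∷ parents a t₂
    ≡⟨ cong₂ (λ xs ys → xs ++ just 0 ∷ ys) eq₁ star ⟩
  flatParents 1 1 bs₁ ++ just 0 ∷ replicate r (just a)
    ≡⟨ cong (λ ys → flatParents 1 1 bs₁ ++ just 0 ∷ ys) (flatParents-replicate (suc a) a r) ⟨
  flatParents 1 1 bs₁ ++ just 0 ∷ flatParents (suc a) a (replicate r false)
    ≡⟨ cong (λ p → flatParents 1 1 bs₁ ++ just 0 ∷ flatParents (suc p) p (replicate r false)) a≡ ⟨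
  flatParents 1 1 bs₁ ++ just 0 ∷ flatParents (2 + length bs₁) (1 + length bs₁) (replicate r false)
    ≡⟨ flatParents-++ 1 1 bs₁ (replicate r false) ⟨
  flatParents 1 1 (bs₁ ++ true ∷ replicate r false) ∎)
  where
  open ≡-Reasoning
  r = length (parents a t₂)
  a≡ : 1 + length bs₁ ≡ a
  a≡ = trans (cong suc (trans (sym (length-flatParents 1 1 bs₁)) (cong length (sym eq₁))))
             (length-parents 0 t₁)

height≤2⇒parents-bitVector : (t : Br (suc (suc m))) → Height≤2 (nothing ∷ parents 0 t) →
  ∃ λ (bv : Vec Bool m) → parents 0 t ≡ just 0 ∷ flatParents 2 1 (toList bv)
height≤2⇒parents-bitVector {m} t h = canonical (height≤2⇒parents-flat t h)
  where
  size : length (parents 0 t) ≡ suc m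
  size = suc-injective (length-parents 0 t)
  canonical : (∃ λ bs → parents 0 t ≡ flatParents 1 1 bs) →
              ∃ λ (bv : Vec Bool m) → parents 0 t ≡ just 0 ∷ flatParents 2 1 (toList bv)
  canonical ([] , eq) = ⊥-elim (1+n≢0 (trans (sym size) (cong length eq)))
  canonical (false ∷ bs , eq) = ⊥-elim (n≮0 (proj₂ (parents-bounded 0 t (cong (_‼ 0) eq))))
  canonical (true ∷ bs , eq)
    with toList-surjective bs (trans (sym (length-flatParents 2 1 bs))
                                     (suc-injective (trans (sym (cong length eq)) size)))
  ... | bv , refl = bv , eq

extend : ∀ {a s} → Br a → Br s → List Bool → Σ ℕ Br
extend t u [] = _ , node t u
extend t u (true ∷ bs) = extend (node t u) leaf bs
extend t u (false ∷ bs) = extend t (node u leaf) bs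

parents-extend : ∀ {a s} (t : Br a) (u : Br s) bs → parents 0 (proj₂ (extend t u bs)) ≡
                 parents 0 t ++ just 0 ∷ parents a u ++ flatParents (a + s) a bs
parents-extend t u [] = cong (λ us → parents 0 t ++ just 0 ∷ us) (sym (++-identityʳ _))
parents-extend {a} {s} t u (true ∷ bs) = begin
  parents 0 (proj₂ (extend (node t u) leaf bs))
    ≡⟨ parents-extend (node t u) leaf bs ⟩
  (parents 0 t ++ just 0 ∷ parents a u) ++ just 0 ∷ flatParents (a + s + 1) (a + s) bs
    ≡⟨ ++-assoc (parents 0 t) _ _ ⟩
  parents 0 t ++ just 0 ∷ parents a u ++ just 0 ∷ flatParents (a + s + 1) (a + s) bs
    ≡⟨ cong (λ p → parents 0 t ++ just 0 ∷ parents a u ++ just 0 ∷ flatParents p (a + s) bs) (+-comm _ 1) ⟩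
  parents 0 t ++ just 0 ∷ parents a u ++ just 0 ∷ flatParents (suc (a + s)) (a + s) bs ∎
  where open ≡-Reasoning
parents-extend {a} {s} t u (false ∷ bs) = begin
  parents 0 (proj₂ (extend t (node u leaf) bs))
    ≡⟨ parents-extend t (node u leaf) bs ⟩
  parents 0 t ++ just 0 ∷ (parents a u ++ just a ∷ []) ++ flatParents (a + (s + 1)) a bs
    ≡⟨ cong (λ us → parents 0 t ++ just 0 ∷ us) (++-assoc (parents a u) _ _) ⟩
  parents 0 t ++ just 0 ∷ parents a u ++ just a ∷ flatParents (a + (s + 1)) a bs
    ≡⟨ cong (λ p → parents 0 t ++ just 0 ∷ parents a u ++ just a ∷ flatParents p a bs)
            (trans (sym (+-assoc a s 1)) (+-comm _ 1)) ⟩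
  parents 0 t ++ just 0 ∷ parents a u ++ just a ∷ flatParents (suc (a + s)) a bs ∎
  where open ≡-Reasoning

parents-subst : ∀ {n n′} k (eq : n ≡ n′) (t : Br n) → parents k (subst Br eq t) ≡ parents k t
parents-subst k refl t = refl

size-extend : (bv : Vec Bool m) → proj₁ (extend leaf leaf (toList bv)) ≡ suc (suc m)
size-extend {m} bv = begin
  proj₁ (extend leaf leaf (toList bv))
    ≡⟨ length-parents 0 (proj₂ (extend leaf leaf (toList bv))) ⟨
  suc (length (parents 0 (proj₂ (extend leaf leaf (toList bv)))))
    ≡⟨ cong (suc ∘ length) (parents-extend leaf leaf (toList bv)) ⟩
  suc (suc (length (flatParents 2 1 (toList bv))))
    ≡⟨ cong (suc ∘ suc) (trans (length-flatParents 2 1 (toList bv)) (length-toList bv)) ⟩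
  suc (suc m) ∎
  where open ≡-Reasoning

shallowBracketing : Vec Bool m → Br (suc (suc m))
shallowBracketing bv = subst Br (size-extend bv) (proj₂ (extend leaf leaf (toList bv)))

parents-shallowBracketing : (bv : Vec Bool m) →
  parents 0 (shallowBracketing bv) ≡ just 0 ∷ flatParents 2 1 (toList bv)
parents-shallowBracketing bv =
  trans (parents-subst 0 (size-extend bv) _) (parents-extend leaf leaf (toList bv))

‼-from-∷ : ∀ (W : List A) pos {x} xs → (∀ i → W ‼ (pos + i) ≡ (x ∷ xs) ‼ i) →
           ∀ i → W ‼ (suc pos + i) ≡ xs ‼ i
‼-from-∷ W pos xs agree i = trans (cong (W ‼_) (sym (+-suc pos i))) (agree (suc i))

flatParents-atDepth≤2 : ∀ W pos c bs → (∀ i → W ‼ (pos + i) ≡ flatParents pos c bs ‼ i) →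
                        Parent W c 0 → ∀ {i} → i < length bs → AtDepth≤2 W (pos + i)
flatParents-atDepth≤2 W pos c (true ∷ bs) agree _ {zero} _ = inj₂ (inj₁ (agree 0))
flatParents-atDepth≤2 W pos c (false ∷ bs) agree c↦0 {zero} _ = inj₂ (inj₂ (c , agree 0 , c↦0))
flatParents-atDepth≤2 W pos c (true ∷ bs) agree _ {suc i} (s≤s i<) =
  subst (AtDepth≤2 W) (sym (+-suc pos i))
    (flatParents-atDepth≤2 W (suc pos) pos bs (‼-from-∷ W pos _ agree) pos↦0 i<)
  where pos↦0 = trans (cong (W ‼_) (sym (+-identityʳ pos))) (agree 0)
flatParents-atDepth≤2 W pos c (false ∷ bs) agree c↦0 {suc i} (s≤s i<) =
  subst (AtDepth≤2 W) (sym (+-suc pos i))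
    (flatParents-atDepth≤2 W (suc pos) c bs (‼-from-∷ W pos _ agree) c↦0 i<)

height≤2-flatParents : ∀ bs → Height≤2 (nothing ∷ just 0 ∷ flatParents 2 1 bs)
height≤2-flatParents bs {zero} _ = inj₁ refl
height≤2-flatParents bs {suc zero} _ = inj₂ (inj₁ refl)
height≤2-flatParents bs {suc (suc i)} (s≤s (s≤s i<)) =
  flatParents-atDepth≤2 (nothing ∷ just 0 ∷ flatParents 2 1 bs) 2 1 bs (λ _ → refl) refl
                        (subst (i <_) (length-flatParents 2 1 bs) i<)

shallowTree : Vec Bool m → Tree (suc (suc m))
shallowTree = G ∘ shallowBracketing

toList-shallowTree : (bv : Vec Bool m) →
  toList (proj₂ (shallowTree bv)) ≡ nothing ∷ just 0 ∷ flatParents 2 1 (toList bv)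
toList-shallowTree bv =
  trans (toList-Gₖ 0 (shallowBracketing bv)) (cong (nothing ∷_) (parents-shallowBracketing bv))

shallowTree-injective : {bv bv′ : Vec Bool m} → shallowTree bv ≡ shallowTree bv′ → bv ≡ bv′
shallowTree-injective {bv = bv} {bv′} eq =
  toList-injective′ (flatParents-injective (toList bv) (toList bv′) (∷-injectiveʳ (∷-injectiveʳ (begin
    nothing ∷ just 0 ∷ flatParents 2 1 (toList bv)    ≡⟨ toList-shallowTree bv ⟨
    toList (proj₂ (shallowTree bv))                   ≡⟨ cong (toList ∘ proj₂) eq ⟩
    toList (proj₂ (shallowTree bv′))                  ≡⟨ toList-shallowTree bv′ ⟩
    nothing ∷ just 0 ∷ flatParents 2 1 (toList bv′)   ∎))))
  where open ≡-Reasoning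

height≤2-shallowTree : (bv : Vec Bool m) → HeightAtMost (shallowTree bv) 2
height≤2-shallowTree bv = Equivalence.from (G-height≤2 (shallowBracketing bv))
  (subst Height≤2 (cong (nothing ∷_) (sym (parents-shallowBracketing bv)))
         (height≤2-flatParents (toList bv)))

height≤2⇒shallowTree : (t : Br (suc (suc m))) → HeightAtMost (G t) 2 → ∃ λ bv → G t ≡ shallowTree bv
height≤2⇒shallowTree t h with height≤2⇒parents-bitVector t (Equivalence.to (G-height≤2 t) h)
... | bv , eq = bv , G-cong t (shallowBracketing bv) (trans eq (sym (parents-shallowBracketing bv)))

bitVectors : ∀ m → List (Vec Bool m)
bitVectors zero = [] ∷ []
bitVectors (suc m) = map (true ∷_) (bitVectors m) ++ map (false ∷_) (bitVectors m)

∈-bitVectors : (bv : Vec Bool m) → bv ∈ bitVectors m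
∈-bitVectors [] = here refl
∈-bitVectors {suc m} (true ∷ bv) = ∈-++⁺ˡ (∈-map⁺ (true ∷_) (∈-bitVectors bv))
∈-bitVectors {suc m} (false ∷ bv) =
  ∈-++⁺ʳ (map (true ∷_) (bitVectors m)) (∈-map⁺ (false ∷_) (∈-bitVectors bv))

bitVectors-unique : ∀ m → Unique (bitVectors m)
bitVectors-unique zero = [] ∷ []
bitVectors-unique (suc m) =
  Unique.++⁺ (Unique.map⁺ ∷-injectiveʳᵛ (bitVectors-unique m))
             (Unique.map⁺ ∷-injectiveʳᵛ (bitVectors-unique m)) disjoint
  where
  disjoint : ∀ {bv} → bv ∈ map (true ∷_) (bitVectors m) × bv ∈ map (false ∷_) (bitVectors m) → ⊥
  disjoint (p , q) with ∈-map⁻ (true ∷_) p | ∈-map⁻ (false ∷_) q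
  ... | _ , _ , refl | _ , _ , ()

length-bitVectors : ∀ m → length (bitVectors m) ≡ 2 ^ m
length-bitVectors zero = refl
length-bitVectors (suc m) = begin
  length (map (true ∷_) (bitVectors m) ++ map (false ∷_) (bitVectors m))
    ≡⟨ length-++ (map (true ∷_) (bitVectors m)) ⟩
  length (map (true ∷_) (bitVectors m)) + length (map (false ∷_) (bitVectors m))
    ≡⟨ cong₂ _+_ (length-map _ (bitVectors m)) (length-map _ (bitVectors m)) ⟩
  length (bitVectors m) + length (bitVectors m)
    ≡⟨ cong (λ k → k + k) (length-bitVectors m) ⟩
  2 ^ m + 2 ^ m
    ≡⟨ cong (2 ^ m +_) (+-identityʳ (2 ^ m)) ⟨
  2 ^ suc m ∎
  where open ≡-Reasoning

lemma8p4 : ∀ n → 1 < n →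
    ∃ λ (L : List (Tree n)) →
      Unique L ×
      (∀ (T : Tree n) → (T ∈ L) ⇔ (IsDFSTree T × HeightAtMost T 2)) ×
      length L ≡ 2 ^ (n ∸ 2)
lemma8p4 (suc (suc m)) (s≤s (s≤s z≤n)) =
  map shallowTree (bitVectors m) ,
  Unique.map⁺ shallowTree-injective (bitVectors-unique m) ,
  (λ T → mk⇔ sound complete) ,
  trans (length-map shallowTree (bitVectors m)) (length-bitVectors m)
  where
  sound : ∀ {T} → T ∈ map shallowTree (bitVectors m) → IsDFSTree T × HeightAtMost T 2
  sound T∈ with ∈-map⁻ shallowTree T∈
  ... | bv , _ , refl = (shallowBracketing bv , refl) , height≤2-shallowTree bv
  complete : ∀ {T} → IsDFSTree T × HeightAtMost T 2 → T ∈ map shallowTree (bitVectors m)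
  complete ((t , refl) , h) with height≤2⇒shallowTree t h
  ... | bv , eq = subst (_∈ map shallowTree (bitVectors m)) (sym eq) (∈-map⁺ shallowTree (∈-bitVectors bv))
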